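{- Let $k\ge 2$. In $GP(2k+1,2)$, for the outer vertices $u_0$ and $u_r$ with $1\le r\le k$ and $r\le 5$, there is a geodesic joining $u_0$ and $u_r$ that is contained in the outer cycle.
   Context: For an integer $n\ge 5$, $GP(n,2)$ is the graph with vertex set $\{u_0,\dots,u_{n-1},v_0,\dots,v_{n-1}\}$ and edges $u_iu_{i+1}$ (outer edges), $u_iv_i$ (spokes) and $v_iv_{i+2}$ (inner edges) for $0\le i\le n-1$, subscripts modulo $n$. The outer cycle is the cycle $u_0u_1\cdots u_{n-1}u_0$. A geodesic is a shortest path. -}

module Defs where

open import Data.Nat using (ℕ; zero; suc; _+_; _≤_; NonZero)
open import Data.Nat.DivMod using (_%_)
open import Data.Fin using (Fin; toℕ)
open import Data.List using (List; []; _∷_)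
open import Data.List.Relation.Unary.All using (All)
open import Data.List.Relation.Unary.Unique.Propositional using (Unique)
open import Data.Product using (_×_)
open import Data.Sum using (_⊎_)
open import Relation.Binary.PropositionalEquality using (_≡_)

-- Vertices of the generalized Petersen graph GP(n,2):
-- out i stands for u_i, inn i stands for v_i.
data V (n : ℕ) : Set where
  out : Fin n → V n
  inn : Fin n → V n

data Adj (n : ℕ) .{{_ : NonZero n}} : V n → V n → Set where
  outer-fwd : (i j : Fin n) → toℕ j ≡ (toℕ i + 1) % n → Adj n (out i) (out j)
  outer-bwd : (i j : Fin n) → toℕ i ≡ (toℕ j + 1) % n → Adj n (out i) (out j)
  spoke-ui  : (i : Fin n) → Adj n (out i) (inn i)
  spoke-vi  : (i : Fin n) → Adj n (inn i) (out i)
  inner-fwd : (i j : Fin n) → toℕ j ≡ (toℕ i + 2) % n → Adj n (inn i) (inn j)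
  inner-bwd : (i j : Fin n) → toℕ i ≡ (toℕ j + 2) % n → Adj n (inn i) (inn j)

data Walk (n : ℕ) .{{_ : NonZero n}} : V n → V n → ℕ → Set where
  [] : (x : V n) → Walk n x x 0
  _∷_ : {x y z : V n} {ℓ : ℕ} → Adj n x y → Walk n y z ℓ → Walk n x z (suc ℓ)

vertices : {n : ℕ} .{{_ : NonZero n}} {x y : V n} {ℓ : ℕ} → Walk n x y ℓ → List (V n)
vertices ([] x) = x ∷ []
vertices (_∷_ {x = x} e w) = x ∷ vertices w

IsPath : {n : ℕ} .{{_ : NonZero n}} {x y : V n} {ℓ : ℕ} → Walk n x y ℓ → Set
IsPath w = Unique (vertices w)

IsGeodesic : {n : ℕ} .{{_ : NonZero n}} {x y : V n} {ℓ : ℕ} → Walk n x y ℓ → Set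
IsGeodesic {n} {x = x} {y} {ℓ} w = IsPath w × (∀ {m} → Walk n x y m → ℓ ≤ m)

data IsOuter {n : ℕ} : V n → Set where
  isOuter : (i : Fin n) → IsOuter (out i)

-- A walk contained in the outer cycle: all its vertices are outer vertices
-- (then all its edges are outer edges, since spokes/inner edges touch inner vertices).
InOuterCycle : {n : ℕ} .{{_ : NonZero n}} {x y : V n} {ℓ : ℕ} → Walk n x y ℓ → Set
InOuterCycle w = All IsOuter (vertices w)

-- Let c(i) = min(i, n − i) be the cyclic distance of u_i from u_0 along the outer cycle. The
-- potential  u_i ↦ min(c(i), 5),  v_i ↦ min(1 + ⌈c(i)/2⌉, 5)  changes by at most 1 along every
-- edge of GP(n,2): an inner edge changes c by at most 2, hence ⌈c/2⌉ by at most 1, and the cap 5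
-- is exactly what keeps spokes Lipschitz (already at c = 6 the uncapped values are 6 and 4).
-- It vanishes at u_0, so every walk from u_0 to u_r has length at least min(r, 5) = r when
-- r ≤ min(k, 5), which is the length of the arc u_0 u_1 ⋯ u_r of the outer cycle.
module Submission where

open import Defs
open import Data.Nat using (ℕ; zero; suc; _+_; _∸_; _*_; _⊓_; _≤_; _<_; z≤n; s≤s; ⌈_/2⌉; NonZero)
open import Data.Nat.Properties
open import Data.Nat.DivMod using (_%_; m<n⇒m%n≡m; [m+n]%n≡m%n)
open import Data.Fin using (Fin; toℕ; zero; fromℕ<)
open import Data.Fin.Properties using (toℕ<n; toℕ-fromℕ<; toℕ-injective)
open import Data.Empty using (⊥)
open import Data.Product using (Σ; _×_; _,_; proj₁; proj₂)
open import Data.Sum using (_⊎_; inj₁; inj₂)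
open import Data.List.Relation.Unary.All as All using (All; []; _∷_)
open import Data.List.Relation.Unary.AllPairs using ([]; _∷_)
open import Data.List.Relation.Unary.Unique.Propositional using (Unique)
open import Relation.Binary.PropositionalEquality
open import Relation.Nullary using (yes; no)

Within : ℕ → ℕ → ℕ → Set
Within d x y = x ≤ d + y × y ≤ d + x

⊓-≤-+-⊓ : ∀ d {x y x′ y′} → x ≤ d + x′ → y ≤ d + y′ → x ⊓ y ≤ d + x′ ⊓ y′
⊓-≤-+-⊓ d {x′ = x′} {y′} p q = ≤-trans (⊓-mono-≤ p q) (≤-reflexive (sym (+-distribˡ-⊓ d x′ y′)))

⊓-lipschitz : ∀ c d {x y} → x ≤ d + y → c ⊓ x ≤ d + c ⊓ y
⊓-lipschitz c d p = ⊓-≤-+-⊓ d (m≤n+m c d) p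

+-%-cases : ∀ n a d .{{_ : NonZero n}} → a < n → d ≤ n →
            (a + d < n × (a + d) % n ≡ a + d) ⊎ ((a + d) % n + n ≡ a + d)
+-%-cases n a d a<n d≤n with a + d <? n
... | yes a+d<n = inj₁ (a+d<n , m<n⇒m%n≡m a+d<n)
... | no a+d≮n = inj₂ (begin
  (a + d) % n + n  ≡⟨ cong (λ m → m % n + n) a+d≡e+n ⟩
  (e + n) % n + n  ≡⟨ cong (_+ n) ([m+n]%n≡m%n e n) ⟩
  e % n + n        ≡⟨ cong (_+ n) (m<n⇒m%n≡m e<n) ⟩
  e + n            ≡⟨ a+d≡e+n ⟨
  a + d            ∎)
  where
  open ≡-Reasoning
  e : ℕ
  e = a + d ∸ n
  a+d≡e+n : a + d ≡ e + n
  a+d≡e+n = trans (sym (m+[n∸m]≡n (≮⇒≥ a+d≮n))) (+-comm n e)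
  e<n : e < n
  e<n = +-cancelʳ-< n e n (subst (_< n + n) a+d≡e+n (+-mono-<-≤ a<n d≤n))

cycDist : ℕ → ℕ → ℕ
cycDist n x = x ⊓ (n ∸ x)

cycDist-no-wrap : ∀ {n} a d → a + d ≤ n → Within d (cycDist n (a + d)) (cycDist n a)
cycDist-no-wrap {n} a d a+d≤n =
  ⊓-≤-+-⊓ d (≤-reflexive (+-comm a d)) (≤-trans (∸-monoʳ-≤ n (m≤m+n a d)) (m≤n+m (n ∸ a) d)) ,
  ⊓-≤-+-⊓ d (≤-trans (m≤m+n a d) (m≤n+m (a + d) d))
            (m≤n+o⇒m∸n≤o n a (≤-reflexive (trans (sym (m+[n∸m]≡n a+d≤n)) (+-assoc a d _))))

cycDist-wrap : ∀ {n} a b d → a < n → b + n ≡ a + d → Within d (cycDist n b) (cycDist n a)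
cycDist-wrap {n} a b d a<n b+n≡a+d =
  ≤-trans (m⊓n≤m b (n ∸ b)) (≤-trans b≤d (m≤m+n d _)) ,
  ≤-trans (m⊓n≤n a (n ∸ a)) (≤-trans n∸a≤d (m≤m+n d _))
  where
  b≤d : b ≤ d
  b≤d = +-cancelʳ-≤ n b d (≤-trans (≤-reflexive b+n≡a+d)
          (≤-trans (+-monoˡ-≤ d (<⇒≤ a<n)) (≤-reflexive (+-comm n d))))
  n∸a≤d : n ∸ a ≤ d
  n∸a≤d = m≤n+o⇒m∸n≤o n a (subst (n ≤_) b+n≡a+d (m≤n+m n b))

cycDist-step : ∀ n a b d .{{_ : NonZero n}} → a < n → d ≤ n → b ≡ (a + d) % n →
               Within d (cycDist n b) (cycDist n a)
cycDist-step n a _ d a<n d≤n refl with +-%-cases n a d a<n d≤n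
... | inj₁ (a+d<n , %≡) rewrite %≡ = cycDist-no-wrap a d (<⇒≤ a+d<n)
... | inj₂ wrap = cycDist-wrap a _ d a<n wrap

x+x≤n⇒cycDist≡x : ∀ {n} x → x + x ≤ n → cycDist n x ≡ x
x+x≤n⇒cycDist≡x x x+x≤n = m≤n⇒m⊓n≡m (m+n≤o⇒m≤o∸n x x+x≤n)

potential : ∀ {n} → V n → ℕ
potential {n} (out i) = 5 ⊓ cycDist n (toℕ i)
potential {n} (inn i) = 5 ⊓ suc ⌈ cycDist n (toℕ i) /2⌉

spoke-within : ∀ c → Within 1 (5 ⊓ suc ⌈ c /2⌉) (5 ⊓ c)
spoke-within 0 = ≤ᵇ⇒≤ _ _ _ , ≤ᵇ⇒≤ _ _ _
spoke-within 1 = ≤ᵇ⇒≤ _ _ _ , ≤ᵇ⇒≤ _ _ _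
spoke-within 2 = ≤ᵇ⇒≤ _ _ _ , ≤ᵇ⇒≤ _ _ _
spoke-within 3 = ≤ᵇ⇒≤ _ _ _ , ≤ᵇ⇒≤ _ _ _
spoke-within 4 = ≤ᵇ⇒≤ _ _ _ , ≤ᵇ⇒≤ _ _ _
spoke-within 5 = ≤ᵇ⇒≤ _ _ _ , ≤ᵇ⇒≤ _ _ _
spoke-within 6 = ≤ᵇ⇒≤ _ _ _ , ≤ᵇ⇒≤ _ _ _
spoke-within (suc (suc (suc (suc (suc (suc (suc c))))))) = ≤ᵇ⇒≤ _ _ _ , ≤ᵇ⇒≤ _ _ _

module _ {n : ℕ} .{{_ : NonZero n}} (2≤n : 2 ≤ n) where

  private
    adjacent-within : ∀ d (i j : Fin n) → d ≤ n → toℕ j ≡ (toℕ i + d) % n →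
                      Within d (cycDist n (toℕ j)) (cycDist n (toℕ i))
    adjacent-within d i j = cycDist-step n (toℕ i) (toℕ j) d (toℕ<n i)

    1≤n : 1 ≤ n
    1≤n = ≤-trans (s≤s z≤n) 2≤n

  potential-adj : ∀ {x y} → Adj n x y → potential y ≤ suc (potential x)
  potential-adj (outer-fwd i j e) = ⊓-lipschitz 5 1 (proj₁ (adjacent-within 1 i j 1≤n e))
  potential-adj (outer-bwd i j e) = ⊓-lipschitz 5 1 (proj₂ (adjacent-within 1 j i 1≤n e))
  potential-adj (spoke-ui i) = proj₁ (spoke-within _)
  potential-adj (spoke-vi i) = proj₂ (spoke-within _)
  potential-adj (inner-fwd i j e) =
    ⊓-lipschitz 5 1 (s≤s (⌈n/2⌉-mono (proj₁ (adjacent-within 2 i j 2≤n e))))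
  potential-adj (inner-bwd i j e) =
    ⊓-lipschitz 5 1 (s≤s (⌈n/2⌉-mono (proj₂ (adjacent-within 2 j i 2≤n e))))

  potential-walk : ∀ {x y ℓ} → Walk n x y ℓ → potential y ≤ ℓ + potential x
  potential-walk ([] x) = ≤-refl
  potential-walk {x} (_∷_ {ℓ = ℓ} e w) =
    ≤-trans (potential-walk w) (≤-trans (+-monoʳ-≤ ℓ (potential-adj e)) (≤-reflexive (+-suc ℓ (potential x))))

OutFrom : ∀ {n} → ℕ → V n → Set
OutFrom a (out j) = a ≤ toℕ j
OutFrom a (inn j) = ⊥

OutFrom⇒IsOuter : ∀ {n a} {v : V n} → OutFrom a v → IsOuter v
OutFrom⇒IsOuter {v = out j} _ = isOuter j

module _ {n : ℕ} .{{_ : NonZero n}} (r : Fin n) where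

  private
    arrived : (i : Fin n) → toℕ i + 0 ≡ toℕ r → i ≡ r
    arrived i e = toℕ-injective (trans (sym (+-identityʳ (toℕ i))) e)

    successor-< : (i : Fin n) (d : ℕ) → toℕ i + suc d ≡ toℕ r → suc (toℕ i) < n
    successor-< i d e =
      ≤-<-trans (subst (suc (toℕ i) ≤_) (trans (sym (+-suc (toℕ i) d)) e) (s≤s (m≤m+n (toℕ i) d))) (toℕ<n r)

    next : (i : Fin n) (d : ℕ) → toℕ i + suc d ≡ toℕ r → Fin n
    next i d e = fromℕ< (successor-< i d e)

    toℕ-next : ∀ i d e → toℕ (next i d e) ≡ suc (toℕ i)
    toℕ-next i d e = toℕ-fromℕ< (successor-< i d e)

    next-adjacent : ∀ i d e → toℕ (next i d e) ≡ (toℕ i + 1) % n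
    next-adjacent i d e = begin
      toℕ (next i d e)  ≡⟨ toℕ-next i d e ⟩
      suc (toℕ i)       ≡⟨ +-comm 1 (toℕ i) ⟩
      toℕ i + 1         ≡⟨ m<n⇒m%n≡m (subst (_< n) (+-comm 1 (toℕ i)) (successor-< i d e)) ⟨
      (toℕ i + 1) % n   ∎
      where open ≡-Reasoning

    next-remaining : ∀ i d e → toℕ (next i d e) + d ≡ toℕ r
    next-remaining i d e = trans (cong (_+ d) (toℕ-next i d e)) (trans (sym (+-suc (toℕ i) d)) e)

  outerArc : (i : Fin n) (d : ℕ) → toℕ i + d ≡ toℕ r → Walk n (out i) (out r) d
  outerArc i zero e with arrived i e
  ... | refl = [] (out i)
  outerArc i (suc d) e = outer-fwd i _ (next-adjacent i d e) ∷ outerArc (next i d e) d (next-remaining i d e)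

  outerArc-from : ∀ a i d e → a ≤ toℕ i → All (OutFrom a) (vertices (outerArc i d e))
  outerArc-from a i zero e a≤i with arrived i e
  ... | refl = a≤i ∷ []
  outerArc-from a i (suc d) e a≤i =
    a≤i ∷ outerArc-from a (next i d e) d _ (≤-trans a≤i (≤-trans (n≤1+n _) (≤-reflexive (sym (toℕ-next i d e)))))

  outerArc-outer : ∀ i d e → All IsOuter (vertices (outerArc i d e))
  outerArc-outer i d e = All.map OutFrom⇒IsOuter (outerArc-from 0 i d e z≤n)

  outerArc-unique : ∀ i d e → Unique (vertices (outerArc i d e))
  outerArc-unique i zero e with arrived i e
  ... | refl = [] ∷ []
  outerArc-unique i (suc d) e =
    All.map out-i≢ (outerArc-from (suc (toℕ i)) (next i d e) d _ (≤-reflexive (sym (toℕ-next i d e))))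
    ∷ outerArc-unique (next i d e) d _
    where
    out-i≢ : ∀ {v} → OutFrom (suc (toℕ i)) v → out i ≢ v
    out-i≢ i<i refl = <-irrefl refl i<i

mainTheorem11 : (k : ℕ) → 2 ≤ k → (r : Fin (suc (2 * k))) → 1 ≤ toℕ r → toℕ r ≤ k → toℕ r ≤ 5 →
    Σ ℕ λ ℓ → Σ (Walk (suc (2 * k)) (out zero) (out r) ℓ) λ w → IsGeodesic w × InOuterCycle w
mainTheorem11 k 2≤k r _ r≤k r≤5 =
  toℕ r , outerArc r zero (toℕ r) refl ,
  (outerArc-unique r zero (toℕ r) refl , shortest) , outerArc-outer r zero (toℕ r) refl
  where
  r+r≤n : toℕ r + toℕ r ≤ suc (2 * k)
  r+r≤n = ≤-trans (+-mono-≤ r≤k (≤-trans r≤k (m≤m+n k 0))) (n≤1+n _)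
  2≤n : 2 ≤ suc (2 * k)
  2≤n = ≤-trans 2≤k (≤-trans (m≤m+n k (k + 0)) (n≤1+n _))
  potential-r : potential (out r) ≡ toℕ r
  potential-r = trans (cong (5 ⊓_) (x+x≤n⇒cycDist≡x (toℕ r) r+r≤n)) (m≥n⇒m⊓n≡n r≤5)
  shortest : ∀ {m} → Walk (suc (2 * k)) (out zero) (out r) m → toℕ r ≤ m
  shortest {m} w = subst₂ _≤_ potential-r (+-identityʳ m) (potential-walk 2≤n w)
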